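{- Let $X$ be a set and let $j$ be a nucleus on $\mathrm{Pow}(X)$ such that the frame $\mathrm{Pow}(X)_j=\{jU\mid U\subseteq X\}$ is overt. Then the sublocale is open: there is $P\subseteq X$ with $j(U)=P\to U=\{x\in X\mid x\in P\Rightarrow x\in U\}$ for all $U\subseteq X$.
   Context: Work constructively (intuitionistic logic, no choice). A nucleus on a frame $L$ is a function $j:L\to L$ with $x\leq j(x)=j(j(x))$ and $j(x\wedge y)=j(x)\wedge j(y)$; the corresponding sublocale is the frame $L_j=\{jx\mid x\in L\}$ with the order of $L$. A positivity predicate on a complete lattice $L$ is a unary predicate $\mathrm{Pos}$ such that: (i) $\mathrm{Pos}(x)$ and $x\leq y$ imply $\mathrm{Pos}(y)$; (ii) $\mathrm{Pos}(\bigvee X)$ implies $\mathrm{Pos}(x)$ for some $x\in X$; (iii) if $\mathrm{Pos}(x)\Rightarrow x\leq y$, then $x\leq y$; $L$ is overt if it has one. A sublocale is open if its nucleus has the form $j(x)=a\to x$ for some $a$. -}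

module Defs where

open import Level using (Level; suc; _⊔_)
open import Data.Product using (Σ; _×_; _,_; ∃-syntax)
open import Relation.Unary using (Pred; _⊆_; _∩_; ⋃)

-- Pow(X) is rendered as Pred X ℓ (subsets of X); equality of subsets
-- is extensional (mutual inclusion).
_≐_ : ∀ {a ℓ} {X : Set a} → Pred X ℓ → Pred X ℓ → Set (a ⊔ ℓ)
U ≐ V = (U ⊆ V) × (V ⊆ U)

-- A nucleus on the frame Pow(X).  'j-cong' records that j is a function
-- on subsets (respects extensional equality of subsets).
record IsNucleus {a ℓ} {X : Set a} (j : Pred X ℓ → Pred X ℓ) : Set (a ⊔ suc ℓ) where
  field
    j-cong     : ∀ {U V} → U ≐ V → j U ≐ j V
    inflate    : ∀ U → U ⊆ j U
    idem       : ∀ U → j (j U) ≐ j U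
    meet-pres  : ∀ U V → j (U ∩ V) ≐ (j U ∩ j V)

-- Elements of the sublocale Pow(X)_j are the subsets of the form j U.
-- Order is inclusion; joins of a family (V i) in Pow(X)_j are j (⋃ V i).
-- A positivity predicate on Pow(X)_j (subsets of Pow(X)_j are rendered
-- as families indexed by a type I : Set ℓ).
record IsPositivity {a ℓ} {X : Set a} (j : Pred X ℓ → Pred X ℓ)
                    (Pos : Pred X ℓ → Set ℓ) : Set (a ⊔ suc ℓ) where
  field
    -- (i) upward closure
    pos-mono : ∀ U V → Pos (j U) → j U ⊆ j V → Pos (j V)
    -- (ii) Pos (⋁ family) implies Pos of some member
    pos-join : ∀ (I : Set ℓ) (V : I → Pred X ℓ) →
               Pos (j (⋃ I (λ i → j (V i)))) → ∃[ i ] Pos (j (V i))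
    -- (iii) positivity principle
    pos-split : ∀ U V → (Pos (j U) → j U ⊆ j V) → j U ⊆ j V

Overt : ∀ {a ℓ} {X : Set a} → (Pred X ℓ → Pred X ℓ) → Set (a ⊔ suc ℓ)
Overt {ℓ = ℓ} {X = X} j = Σ (Pred X ℓ → Set ℓ) (IsPositivity j)

module Submission where

-- Let Pos be a positivity predicate on Pow(X)_j.  The open subset is
--   P = { x | Pos (j ｛x｝) },
-- the points whose closure is positive, and we show j U = (P → U).
--  * (⊇) Given x with P x → U x, the positivity principle (iii) applied
--    to j ｛x｝ ⊆ j U reduces to the case Pos (j ｛x｝), where x ∈ U.
--  * (⊆) Given x ∈ j U, the point closure j ｛x｝ lies below the join
--    W = ⋁ { j ｛x｝ | proof of x ∈ U }, a join indexed by the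
--    proposition "x ∈ U".  If j ｛x｝ is positive, so is W by (i), and
--    (ii) then yields an index, i.e. a proof of x ∈ U.

open import Defs
open import Level using (Level)
open import Data.Product using (Σ; _,_; proj₁; proj₂)
open import Relation.Unary using (Pred; _⊆_; _∩_; ⋃; ｛_｝)
open import Relation.Binary.PropositionalEquality using (refl)

module NucleusFacts {a ℓ} {X : Set a} {j : Pred X ℓ → Pred X ℓ}
                    (nuc : IsNucleus j) where
  open IsNucleus nuc

  -- A nucleus is monotone: it preserves binary meets, and A ⊆ B means A = A ∩ B.
  j-mono : ∀ {A B : Pred X ℓ} → A ⊆ B → j A ⊆ j B
  j-mono {A} {B} A⊆B jAx =
    proj₂ (proj₁ (meet-pres A B) (proj₁ (j-cong A≐A∩B) jAx))
    where
    A≐A∩B : A ≐ (A ∩ B)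
    A≐A∩B = (λ Ax → Ax , A⊆B Ax) , proj₁

  j-least : ∀ {A B : Pred X ℓ} → A ⊆ j B → j A ⊆ j B
  j-least {B = B} A⊆jB jAx = proj₁ (idem B) (j-mono A⊆jB jAx)

module PointClosure {ℓ} {X : Set ℓ} {j : Pred X ℓ → Pred X ℓ}
                    (nuc : IsNucleus j) where
  open IsNucleus nuc
  open NucleusFacts nuc

  -- The join of copies of j ｛x｝, one for each proof that x ∈ U:
  -- it is j ｛x｝ if x ∈ U and empty otherwise.
  guarded : Pred X ℓ → X → Pred X ℓ
  guarded U x = ⋃ (U x) (λ _ → j ｛ x ｝)

  -- If x ∈ j U, the closure of x already lies below the closure of
  -- its U-guarded copy: x ∈ j ｛x｝ ∩ j U = j (｛x｝ ∩ U), and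
  -- ｛x｝ ∩ U is contained in that guarded join.
  point-below-guarded : ∀ {U : Pred X ℓ} {x : X} →
                        j U x → j ｛ x ｝ ⊆ j (guarded U x)
  point-below-guarded {U} {x} jUx = j-least x∈jguarded
    where
    point∩U⊆guarded : (｛ x ｝ ∩ U) ⊆ guarded U x
    point∩U⊆guarded (refl , Ux) = Ux , inflate ｛ x ｝ refl

    x∈jguarded : ｛ x ｝ ⊆ j (guarded U x)
    x∈jguarded refl =
      j-mono point∩U⊆guarded
        (proj₂ (meet-pres ｛ x ｝ U) (inflate ｛ x ｝ refl , jUx))

module PositivityFacts {a ℓ} {X : Set a} {j : Pred X ℓ → Pred X ℓ}
                       {Pos : Pred X ℓ → Set ℓ} (isPos : IsPositivity j Pos) where
  open IsPositivity isPos

  positive-join-inhabited : ∀ (Q : Set ℓ) (V : Pred X ℓ) →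
                            Pos (j (⋃ Q (λ _ → j V))) → Q
  positive-join-inhabited Q V posJoin = proj₁ (pos-join Q (λ _ → V) posJoin)

lemma5p6 : ∀ {ℓ : Level} (X : Set ℓ) (j : Pred X ℓ → Pred X ℓ) →
    IsNucleus j → Overt j →
    Σ (Pred X ℓ) (λ P → ∀ (U : Pred X ℓ) → j U ≐ (λ x → P x → U x))
lemma5p6 {ℓ} X j nuc (Pos , isPos) = P , λ U → closed⊆open U , open⊆closed U
  where
  open IsNucleus nuc
  open IsPositivity isPos
  open NucleusFacts nuc
  open PointClosure nuc
  open PositivityFacts isPos

  P : Pred X ℓ
  P x = Pos (j ｛ x ｝)

  closed⊆open : ∀ U → j U ⊆ (λ x → P x → U x)
  closed⊆open U {x} jUx Px =
    positive-join-inhabited (U x) ｛ x ｝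
      (pos-mono ｛ x ｝ (guarded U x) Px (point-below-guarded jUx))

  open⊆closed : ∀ U → (λ x → P x → U x) ⊆ j U
  open⊆closed U {x} P⇒Ux = pos-split ｛ x ｝ U point⊆jU (inflate ｛ x ｝ refl)
    where
    point⊆jU : P x → j ｛ x ｝ ⊆ j U
    point⊆jU Px = j-mono (λ { refl → P⇒Ux Px })
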